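{- For all positive integers $p,k,n,m$ with $m \leq k$, \[ L_p(n,m,k) = \sum_{j \geq p} (-1)^{j-p}\binom{j-1}{p-1}F(n+1-jm,k,j). \]
   Context: A composition of $n$ is a finite sequence of positive integers summing to $n$. $L_p(n,m,k)$ is the number of compositions of $n$ all of whose parts are at most $k$ and having at least $p$ parts equal to $m$. For $k\ge 1$: $F(n,k)=0$ for $n\le0$, $F(1,k)=1$, $F(n,k)=\sum_{j=1}^kF(n-j,k)$ for $n\ge2$. For $r\ge0$, $F(n+1,k,r)$ is the coefficient of $x^n$ in $\left(\sum_{j\ge0}F(j+1,k)x^j\right)^{r+1}$ for $n\ge0$, and $F(n,k,r)=0$ for $n\le 0$. -}

module Defs where

open import Data.Nat using (ℕ; zero; suc; _+_; _*_; _∸_; _≤_; _≤?_; _≟_)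
open import Data.Nat.Combinatorics using (_C_)
open import Data.Integer as ℤ using (ℤ; +_; -[1+_]; 0ℤ; -1ℤ)
open import Data.List using (List; []; _∷_; map; concatMap; filter; length; upTo; take; foldr)
open import Data.Nat.ListAction using (sum)
open import Data.List.Relation.Unary.All using (All; all?)
open import Data.Product using (_×_)
open import Relation.Nullary.Decidable using (_×-dec_)
open import Relation.Binary.PropositionalEquality using (_≡_)

-- k-generalized Fibonacci numbers F(n,k), for n : ℕ
-- (F(0,k) = 0, F(1,k) = 1, F(n,k) = Σ_{j=1}^k F(n-j,k) for n ≥ 2,
--  with F(n,k) = 0 for n ≤ 0).
-- fibList k n = [F(n,k), F(n-1,k), ..., F(0,k)]; since F vanishes at
-- nonpositive indices, Σ_{j=1}^k F(n+1-j,k) = sum (take k (fibList k n)).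

fibList : ℕ → ℕ → List ℕ
fibList k zero          = 0 ∷ []
fibList k (suc zero)    = 1 ∷ 0 ∷ []
fibList k (suc (suc n)) = sum (take k (fibList k (suc n))) ∷ fibList k (suc n)

headOr0 : List ℕ → ℕ
headOr0 []      = 0
headOr0 (x ∷ _) = x

F : ℕ → ℕ → ℕ
F n k = headOr0 (fibList k n)

-- coef k r n = coefficient of x^n in (Σ_{j≥0} F(j+1,k) x^j)^(r+1)
-- (Cauchy product, by recursion on r).

coef : ℕ → ℕ → ℕ → ℕ
coef k zero    n = F (suc n) k
coef k (suc r) n = sum (map (λ i → F (suc i) k * coef k r (n ∸ i)) (upTo (suc n)))

F3 : ℤ → ℕ → ℕ → ℕ
F3 (+ zero)    k r = 0
F3 (+ (suc n)) k r = coef k r n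
F3 -[1+ _ ]    k r = 0

listsOf : ℕ → ℕ → List (List ℕ)
listsOf n zero    = [] ∷ []
listsOf n (suc ℓ) = concatMap (λ i → map (suc i ∷_) (listsOf n ℓ)) (upTo n)

-- candidates n : all lists of positive integers, each ≤ n, of length ≤ n.
-- Every composition of n appears exactly once.
candidates : ℕ → List (List ℕ)
candidates n = concatMap (listsOf n) (upTo (suc n))

countEq : ℕ → List ℕ → ℕ
countEq m c = length (filter (_≟ m) c)

IsLComp : ℕ → ℕ → ℕ → ℕ → List ℕ → Set
IsLComp p n m k c = (sum c ≡ n) × (All (_≤ k) c × (p ≤ countEq m c))

isLComp? : ∀ p n m k c → Relation.Nullary.Decidable.Dec (IsLComp p n m k c)
isLComp? p n m k c = (sum c ≟ n) ×-dec (all? (_≤? k) c ×-dec (p ≤? countEq m c))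

L : ℕ → ℕ → ℕ → ℕ → ℕ
L p n m k = length (filter (isLComp? p n m k) (candidates n))

sumℤ : List ℤ → ℤ
sumℤ = foldr ℤ._+_ 0ℤ

term : ℕ → ℕ → ℕ → ℕ → ℕ → ℤ
term p n m k j =
  (-1ℤ ℤ.^ (j ∸ p)) ℤ.* ((+ ((j ∸ 1) C (p ∸ 1)))
    ℤ.* (+ F3 ((+ (n + 1)) ℤ.- (+ (j * m))) k j))

-- Σ_{j ≥ p} term j, truncated to p ≤ j ≤ p + n: for j ≥ n+1 and m ≥ 1,
-- n+1-jm ≤ 0 so the term vanishes.
RHS : ℕ → ℕ → ℕ → ℕ → ℤ
RHS p n m k = sumℤ (map (λ i → term p n m k (p + i)) (upTo (suc n)))

module Submission where

-- Sequences ℕ → A are read as power series; `shift a f` is x^a·f.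
-- (1) Fibonacci side.  c(n) = F(n+1,k) satisfies c = δ + Σ_{a<k} x^{a+1} c
--     (δ = 1, 0, 0, …), hence the Cauchy powers C_r = c^{r+1} (coef k r) satisfy
--     C_{r+1} = C_r + Σ_{a<k} x^{a+1} C_{r+1}, and U_j = x^{jm} C_j satisfies
--     U_{j+1} = x^m U_j + Σ_{a<k} x^{a+1} U_{j+1}.
-- (2) Counting side.  Splitting off the first part of a composition gives
--     L_0 = δ + Σ_{a<k} x^{a+1} L_0 and, when 1 ≤ m ≤ k,
--     L_{q+1} = x^m L_q - x^m L_{q+1} + Σ_{a<k} x^{a+1} L_{q+1}.
-- (3) The alternating sums R_q = Σ_i (-1)^i C(q+i,q) U_{q+1+i} satisfy the same
--     recurrence as L_{q+1} (the x^m terms telescope by Pascal's rule).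
--     A recurrence expressing f(n) through f(0..n-1) has at most one solution,
--     so by induction on q: L_0 = U_0 and L_{q+1} = R_q, and R_q is the RHS.

open import Defs
open import Data.Nat using (ℕ; _≤_; NonZero)
open import Data.Integer using (+_)
open import Relation.Binary.PropositionalEquality using (_≡_)

open import Data.Nat using (zero; suc; _+_; _*_; _∸_; _<_; z≤n; s≤s; _≤?_; _≟_)
import Data.Nat.Properties as ℕP
open import Data.Nat.Combinatorics using (_C_; nCn≡1; nCk+nC[k+1]≡[n+1]C[k+1])
open import Data.Integer as ℤ using (ℤ; 0ℤ; -1ℤ)
import Data.Integer.Properties as ℤP
open import Data.Integer.Tactic.RingSolver using (solve-∀)
open import Data.List using (List; []; _∷_; map; applyUpTo; foldr; filter; length; concatMap; _++_; upTo; take)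
open import Data.List.Properties using (filter-++; length-++; filter-none; filter-accept; filter-reject)
open import Data.Nat.ListAction using (sum)
open import Data.List.Relation.Unary.All using ([]; _∷_; universal)
open import Data.List.Relation.Unary.All.Properties using (map⁺)
open import Data.Product using (_,_)
open import Data.Sum using (inj₁; inj₂)
open import Data.Empty using (⊥-elim)
open import Relation.Nullary using (Dec; yes; no; ¬_)
open import Relation.Unary using (Pred; Decidable)
open import Relation.Binary.PropositionalEquality
  using (refl; sym; trans; cong; cong₂; subst; module ≡-Reasoning)
open import Function using (_∘_)
open import Level using (0ℓ)
open import Algebra.Bundles using (CommutativeSemigroup)
open import Algebra.Structures using (IsCommutativeMonoid)

-- `shift z a f` is f delayed by a places and padded with z in front;
-- on power series it is multiplication by x^a.
shift : {A : Set} → A → ℕ → (ℕ → A) → ℕ → A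
shift z zero    f n       = f n
shift z (suc a) f zero    = z
shift z (suc a) f (suc n) = shift z a f n

module _ {A : Set} (z : A) where

  shift-≥ : ∀ a n (f : ℕ → A) → a ≤ n → shift z a f n ≡ f (n ∸ a)
  shift-≥ zero    n       f _       = refl
  shift-≥ (suc a) (suc n) f (s≤s p) = shift-≥ a n f p

  shift-< : ∀ a n (f : ℕ → A) → n < a → shift z a f n ≡ z
  shift-< (suc a) zero    f _       = refl
  shift-< (suc a) (suc n) f (s≤s p) = shift-< a n f p

  shift-cong : ∀ a n (f g : ℕ → A) → (∀ t → t ≤ n → f t ≡ g t) →
               shift z a f n ≡ shift z a g n
  shift-cong zero    n       f g h = h n ℕP.≤-refl
  shift-cong (suc a) zero    f g h = refl
  shift-cong (suc a) (suc n) f g h = shift-cong a n f g (λ t p → h t (ℕP.m≤n⇒m≤1+n p))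

  shift-cong-< : ∀ a n (f g : ℕ → A) → (∀ t → t < n → f t ≡ g t) →
                 shift z (suc a) f n ≡ shift z (suc a) g n
  shift-cong-< a zero    f g h = refl
  shift-cong-< a (suc n) f g h = shift-cong a n f g (λ t p → h t (s≤s p))

  shift-+ : ∀ a b n (f : ℕ → A) → shift z (a + b) f n ≡ shift z a (shift z b f) n
  shift-+ zero    b n       f = refl
  shift-+ (suc a) b zero    f = refl
  shift-+ (suc a) b (suc n) f = shift-+ a b n f

  shift-comm : ∀ a b n (f : ℕ → A) → shift z a (shift z b f) n ≡ shift z b (shift z a f) n
  shift-comm a b n f = begin
    shift z a (shift z b f) n  ≡⟨ shift-+ a b n f ⟨
    shift z (a + b) f n        ≡⟨ cong (λ d → shift z d f n) (ℕP.+-comm a b) ⟩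
    shift z (b + a) f n        ≡⟨ shift-+ b a n f ⟩
    shift z b (shift z a f) n  ∎
    where open ≡-Reasoning

  shift-const : ∀ a n → shift z a (λ _ → z) n ≡ z
  shift-const zero    n       = refl
  shift-const (suc a) zero    = refl
  shift-const (suc a) (suc n) = shift-const a n

shift-map : ∀ {A B : Set} {z : A} {w : B} (φ : A → B) → φ z ≡ w →
            ∀ a n (f : ℕ → A) → φ (shift z a f n) ≡ shift w a (φ ∘ f) n
shift-map φ e zero    n       f = refl
shift-map φ e (suc a) zero    f = e
shift-map φ e (suc a) (suc n) f = shift-map φ e a n f

module Sums {A : Set} {_⊕_ : A → A → A} {e : A}
            (isCM : IsCommutativeMonoid _≡_ _⊕_ e) where

  open IsCommutativeMonoid isCM
    using (assoc; identityˡ; identityʳ; isCommutativeSemigroup)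

  -- Bundled so that the library's interchange law applies.
  commutativeSemigroup : CommutativeSemigroup 0ℓ 0ℓ
  commutativeSemigroup = record
    { Carrier = A ; _≈_ = _≡_ ; _∙_ = _⊕_ ; isCommutativeSemigroup = isCommutativeSemigroup }

  open import Algebra.Properties.CommutativeSemigroup commutativeSemigroup
    using (interchange)

  Σ : ℕ → (ℕ → A) → A
  Σ zero    g = e
  Σ (suc T) g = g 0 ⊕ Σ T (g ∘ suc)

  Σ-applyUpTo : ∀ T (f : ℕ → ℕ) (g : ℕ → A) →
                foldr _⊕_ e (map g (applyUpTo f T)) ≡ Σ T (g ∘ f)
  Σ-applyUpTo zero    f g = refl
  Σ-applyUpTo (suc T) f g = cong (g (f 0) ⊕_) (Σ-applyUpTo T (f ∘ suc) g)

  Σ-congᵇ : ∀ T (f g : ℕ → A) → (∀ i → i < T → f i ≡ g i) → Σ T f ≡ Σ T g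
  Σ-congᵇ zero    f g h = refl
  Σ-congᵇ (suc T) f g h =
    cong₂ _⊕_ (h 0 (s≤s z≤n)) (Σ-congᵇ T _ _ (λ i p → h (suc i) (s≤s p)))

  Σ-cong : ∀ T (f g : ℕ → A) → (∀ i → f i ≡ g i) → Σ T f ≡ Σ T g
  Σ-cong T f g h = Σ-congᵇ T f g (λ i _ → h i)

  Σ-zero : ∀ T (g : ℕ → A) → (∀ i → i < T → g i ≡ e) → Σ T g ≡ e
  Σ-zero zero    g h = refl
  Σ-zero (suc T) g h =
    trans (cong₂ _⊕_ (h 0 (s≤s z≤n)) (Σ-zero T _ (λ i p → h (suc i) (s≤s p)))) (identityˡ e)

  Σ-+ : ∀ T (f g : ℕ → A) → Σ T (λ i → f i ⊕ g i) ≡ Σ T f ⊕ Σ T g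
  Σ-+ zero    f g = sym (identityˡ e)
  Σ-+ (suc T) f g = trans (cong ((f 0 ⊕ g 0) ⊕_) (Σ-+ T _ _)) (interchange _ _ _ _)

  Σ-swap : ∀ S T (h : ℕ → ℕ → A) →
           Σ S (λ i → Σ T (λ j → h i j)) ≡ Σ T (λ j → Σ S (λ i → h i j))
  Σ-swap zero    T h = sym (Σ-zero T _ (λ _ _ → refl))
  Σ-swap (suc S) T h =
    trans (cong (Σ T (h 0) ⊕_) (Σ-swap S T (h ∘ suc))) (sym (Σ-+ T _ _))

  Σ-split : ∀ N d (g : ℕ → A) → Σ (N + d) g ≡ Σ N g ⊕ Σ d (λ i → g (N + i))
  Σ-split zero    d g = sym (identityˡ _)
  Σ-split (suc N) d g = trans (cong (g 0 ⊕_) (Σ-split N d (g ∘ suc))) (sym (assoc _ _ _))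

  Σ-truncate : ∀ N T (g : ℕ → A) → (∀ i → N ≤ i → g i ≡ e) → N ≤ T → Σ T g ≡ Σ N g
  Σ-truncate N T g h N≤T with ℕP.m≤n⇒∃[o]m+o≡n N≤T
  ... | d , refl = begin
    Σ (N + d) g                          ≡⟨ Σ-split N d g ⟩
    Σ N g ⊕ Σ d (λ i → g (N + i))        ≡⟨ cong (Σ N g ⊕_) (Σ-zero d _ (λ i _ → h (N + i) (ℕP.m≤m+n N i))) ⟩
    Σ N g ⊕ e                            ≡⟨ identityʳ _ ⟩
    Σ N g                                ∎
    where open ≡-Reasoning

  Σ-shift : ∀ a T n (h : ℕ → ℕ → A) →
            shift e a (λ t → Σ T (λ i → h i t)) n ≡ Σ T (λ i → shift e a (h i) n)
  Σ-shift zero    T n       h = refl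
  Σ-shift (suc a) T zero    h = sym (Σ-zero T _ (λ _ _ → refl))
  Σ-shift (suc a) T (suc n) h = Σ-shift a T n h

  shift-⊕ : ∀ a n (f g : ℕ → A) → shift e a (λ t → f t ⊕ g t) n ≡ shift e a f n ⊕ shift e a g n
  shift-⊕ zero    n       f g = refl
  shift-⊕ (suc a) zero    f g = sym (identityˡ e)
  shift-⊕ (suc a) (suc n) f g = shift-⊕ a n f g

module ΣN = Sums ℕP.+-0-isCommutativeMonoid
module ΣZ = Sums ℤP.+-0-isCommutativeMonoid

shiftℕ : ℕ → (ℕ → ℕ) → ℕ → ℕ
shiftℕ = shift 0

shiftℤ : ℕ → (ℕ → ℤ) → ℕ → ℤ
shiftℤ = shift 0ℤ

Σ-*ʳ : ∀ T (f : ℕ → ℕ) x → ΣN.Σ T f * x ≡ ΣN.Σ T (λ i → f i * x)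
Σ-*ʳ zero    f x = refl
Σ-*ʳ (suc T) f x = trans (ℕP.*-distribʳ-+ x (f 0) _) (cong (_+_ (f 0 * x)) (Σ-*ʳ T _ x))

module _ {A : Set} {P : Pred A 0ℓ} (P? : Decidable P) where

  count-++ : ∀ xs ys →
             length (filter P? (xs ++ ys)) ≡ length (filter P? xs) + length (filter P? ys)
  count-++ xs ys = trans (cong length (filter-++ P? xs ys)) (length-++ (filter P? xs))

  count-concatMap : ∀ {B : Set} (f : B → List A) xs →
    length (filter P? (concatMap f xs)) ≡ sum (map (λ x → length (filter P? (f x))) xs)
  count-concatMap f []       = refl
  count-concatMap f (x ∷ xs) =
    trans (count-++ (f x) _) (cong (_+_ (length (filter P? (f x)))) (count-concatMap f xs))

  count-none : ∀ {B : Set} (f : B → A) xs → (∀ y → ¬ P (f y)) → length (filter P? (map f xs)) ≡ 0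
  count-none f xs h = cong length (filter-none P? (map⁺ (universal h xs)))

count-map : ∀ {A B : Set} {P : Pred A 0ℓ} {Q : Pred B 0ℓ} (P? : Decidable P) (Q? : Decidable Q)
            (f : B → A) → (∀ y → P (f y) → Q y) → (∀ y → Q y → P (f y)) →
            ∀ ys → length (filter P? (map f ys)) ≡ length (filter Q? ys)
count-map P? Q? f to from []       = refl
count-map P? Q? f to from (y ∷ ys) with P? (f y) | Q? y
... | yes p | yes q = cong suc (count-map P? Q? f to from ys)
... | yes p | no ¬q = ⊥-elim (¬q (to y p))
... | no ¬p | yes q = ⊥-elim (¬p (from y q))
... | no ¬p | no ¬q = count-map P? Q? f to from ys

δ : ℕ → ℕ
δ zero    = 1
δ (suc n) = 0

conv : (ℕ → ℕ) → (ℕ → ℕ) → ℕ → ℕ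
conv g h n = ΣN.Σ (suc n) (λ i → g i * h (n ∸ i))

conv-shiftˡ : ∀ b n (g h : ℕ → ℕ) → conv (shiftℕ b g) h n ≡ shiftℕ b (conv g h) n
conv-shiftˡ zero    n       g h = refl
conv-shiftˡ (suc b) zero    g h = refl
conv-shiftˡ (suc b) (suc n) g h = conv-shiftˡ b n g h

conv-δ : ∀ n (h : ℕ → ℕ) → conv δ h n ≡ h n
conv-δ n h = begin
  h n + 0 + ΣN.Σ n (λ _ → 0)  ≡⟨ cong (_+_ (h n + 0)) (ΣN.Σ-zero n _ (λ _ _ → refl)) ⟩
  h n + 0 + 0                 ≡⟨ trans (ℕP.+-identityʳ _) (ℕP.+-identityʳ _) ⟩
  h n                         ∎
  where open ≡-Reasoning

module Fibonacci (k : ℕ) where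

  c : ℕ → ℕ
  c n = F (suc n) k

  fibList-suc : ∀ n → fibList k (suc n) ≡ F (suc n) k ∷ fibList k n
  fibList-suc zero    = refl
  fibList-suc (suc n) = refl

  sum-take-fibList : ∀ K n → sum (take K (fibList k n)) ≡ ΣN.Σ K (λ a → shiftℕ a (λ t → F t k) n)
  sum-take-fibList zero          n       = refl
  sum-take-fibList (suc zero)    zero    = refl
  sum-take-fibList (suc (suc K)) zero    = sym (ΣN.Σ-zero K _ (λ _ _ → refl))
  sum-take-fibList (suc K)       (suc n) rewrite fibList-suc n =
    cong (_+_ (F (suc n) k)) (sum-take-fibList K n)

  shift-F : ∀ a n → shiftℕ a (λ t → F t k) (suc n) ≡ shiftℕ a c n
  shift-F zero          n       = refl
  shift-F (suc zero)    zero    = refl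
  shift-F (suc (suc a)) zero    = refl
  shift-F (suc a)       (suc n) = shift-F a n

  c-rec : ∀ n → c n ≡ δ n + ΣN.Σ k (λ a → shiftℕ (suc a) c n)
  c-rec zero    = sym (cong suc (ΣN.Σ-zero k _ (λ _ _ → refl)))
  c-rec (suc n) = trans (sum-take-fibList k (suc n)) (ΣN.Σ-cong k _ _ (λ a → shift-F a n))

  coef-suc : ∀ r n → coef k (suc r) n ≡ conv c (coef k r) n
  coef-suc r n = ΣN.Σ-applyUpTo (suc n) (λ i → i) _

  -- Multiplying c-rec by C_r:  C_{r+1} = C_r + Σ_{a<k} x^{a+1} C_{r+1}.
  coef-rec : ∀ r n → coef k (suc r) n ≡ coef k r n + ΣN.Σ k (λ a → shiftℕ (suc a) (coef k (suc r)) n)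
  coef-rec r n = begin
      coef k (suc r) n
    ≡⟨ coef-suc r n ⟩
      ΣN.Σ (suc n) (λ i → c i * Cr (n ∸ i))
    ≡⟨ ΣN.Σ-cong (suc n) _ _ (λ i → trans (cong (_* Cr (n ∸ i)) (c-rec i))
                                         (ℕP.*-distribʳ-+ (Cr (n ∸ i)) (δ i) _)) ⟩
      ΣN.Σ (suc n) (λ i → δ i * Cr (n ∸ i) + tail i * Cr (n ∸ i))
    ≡⟨ ΣN.Σ-+ (suc n) (λ i → δ i * Cr (n ∸ i)) (λ i → tail i * Cr (n ∸ i)) ⟩
      conv δ Cr n + ΣN.Σ (suc n) (λ i → tail i * Cr (n ∸ i))
    ≡⟨ cong₂ _+_ (conv-δ n Cr) (ΣN.Σ-cong (suc n) _ _ (λ i → Σ-*ʳ k (λ a → shiftℕ (suc a) c i) (Cr (n ∸ i)))) ⟩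
      Cr n + ΣN.Σ (suc n) (λ i → ΣN.Σ k (λ a → shiftℕ (suc a) c i * Cr (n ∸ i)))
    ≡⟨ cong (_+_ (Cr n)) (ΣN.Σ-swap (suc n) k (λ i a → shiftℕ (suc a) c i * Cr (n ∸ i))) ⟩
      Cr n + ΣN.Σ k (λ a → conv (shiftℕ (suc a) c) Cr n)
    ≡⟨ cong (_+_ (Cr n)) (ΣN.Σ-cong k _ _ (λ a →
         trans (conv-shiftˡ (suc a) n c Cr)
               (shift-cong 0 (suc a) n _ _ (λ t _ → sym (coef-suc r t))))) ⟩
      Cr n + ΣN.Σ k (λ a → shiftℕ (suc a) (coef k (suc r)) n)
    ∎
    where
      open ≡-Reasoning
      Cr : ℕ → ℕ
      Cr = coef k r
      tail : ℕ → ℕ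
      tail i = ΣN.Σ k (λ a → shiftℕ (suc a) c i)

  module Shifted (m : ℕ) where

    -- U_j = x^{jm} C_j, the series whose n-th coefficient is F(n+1-jm,k,j).
    U : ℕ → ℕ → ℕ
    U j = shiftℕ (j * m) (coef k j)

    -- coef-rec shifted by x^{jm}:  U_{j+1} = x^m U_j + Σ_{a<k} x^{a+1} U_{j+1}.
    U-rec : ∀ j n → U (suc j) n ≡ shiftℕ m (U j) n + ΣN.Σ k (λ a → shiftℕ (suc a) (U (suc j)) n)
    U-rec j n = begin
        U (suc j) n
      ≡⟨ shift-+ 0 m (j * m) n C′ ⟩
        shiftℕ m (shiftℕ (j * m) C′) n
      ≡⟨ shift-cong 0 m n _ _ (λ t _ → shifted-rec t) ⟩
        shiftℕ m (λ t → U j t + ΣN.Σ k (λ a → shiftℕ (suc a) (shiftℕ (j * m) C′) t)) n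
      ≡⟨ ΣN.shift-⊕ m n _ _ ⟩
        shiftℕ m (U j) n + shiftℕ m (λ t → ΣN.Σ k (λ a → shiftℕ (suc a) (shiftℕ (j * m) C′) t)) n
      ≡⟨ cong (_+_ (shiftℕ m (U j) n)) (ΣN.Σ-shift m k n _) ⟩
        shiftℕ m (U j) n + ΣN.Σ k (λ a → shiftℕ m (shiftℕ (suc a) (shiftℕ (j * m) C′)) n)
      ≡⟨ cong (_+_ (shiftℕ m (U j) n)) (ΣN.Σ-cong k _ _ (λ a →
           trans (shift-comm 0 m (suc a) n _)
                 (shift-cong 0 (suc a) n _ _ (λ t _ → sym (shift-+ 0 m (j * m) t C′))))) ⟩
        shiftℕ m (U j) n + ΣN.Σ k (λ a → shiftℕ (suc a) (U (suc j)) n)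
      ∎
      where
        open ≡-Reasoning
        C′ : ℕ → ℕ
        C′ = coef k (suc j)
        shifted-rec : ∀ t → shiftℕ (j * m) C′ t ≡
                            U j t + ΣN.Σ k (λ a → shiftℕ (suc a) (shiftℕ (j * m) C′) t)
        shifted-rec t = begin
            shiftℕ (j * m) C′ t
          ≡⟨ shift-cong 0 (j * m) t _ _ (λ t′ _ → coef-rec j t′) ⟩
            shiftℕ (j * m) (λ t′ → coef k j t′ + ΣN.Σ k (λ a → shiftℕ (suc a) C′ t′)) t
          ≡⟨ ΣN.shift-⊕ (j * m) t _ _ ⟩
            U j t + shiftℕ (j * m) (λ t′ → ΣN.Σ k (λ a → shiftℕ (suc a) C′ t′)) t
          ≡⟨ cong (_+_ (U j t)) (trans (ΣN.Σ-shift (j * m) k t _)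
                                     (ΣN.Σ-cong k _ _ (λ a → shift-comm 0 (j * m) (suc a) t C′))) ⟩
            U j t + ΣN.Σ k (λ a → shiftℕ (suc a) (shiftℕ (j * m) C′) t)
          ∎

gate : ∀ {A : Set} → Dec A → ℕ → ℕ
gate (yes _) x = x
gate (no _)  x = 0

gate-yes : ∀ {A : Set} (d : Dec A) x → A → gate d x ≡ x
gate-yes (yes _) x a = refl
gate-yes (no ¬a) x a = ⊥-elim (¬a a)

gate-no : ∀ {A : Set} (d : Dec A) x → ¬ A → gate d x ≡ 0
gate-no (yes a) x ¬a = ⊥-elim (¬a a)
gate-no (no _)  x _  = refl

module Compositions (k m : ℕ) where

  isM : ℕ → ℕ
  isM x = countEq m (x ∷ [])

  isM-m : isM m ≡ 1
  isM-m = cong length (filter-accept (_≟ m) {xs = []} refl)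

  isM-≢ : ∀ x → ¬ x ≡ m → isM x ≡ 0
  isM-≢ x x≢m = cong length (filter-reject (_≟ m) {xs = []} x≢m)

  countEq-∷ : ∀ x ys → countEq m (x ∷ ys) ≡ isM x + countEq m ys
  countEq-∷ x ys = count-++ (_≟ m) (x ∷ []) ys

  atLeast-∷⇒ : ∀ q x ys → q ≤ countEq m (x ∷ ys) → q ∸ isM x ≤ countEq m ys
  atLeast-∷⇒ q x ys p = ℕP.m≤n+o⇒m∸n≤o q (isM x) (subst (q ≤_) (countEq-∷ x ys) p)

  atLeast-∷⇐ : ∀ q x ys → q ∸ isM x ≤ countEq m ys → q ≤ countEq m (x ∷ ys)
  atLeast-∷⇐ q x ys p = subst (q ≤_) (sym (countEq-∷ x ys))
    (ℕP.≤-trans (ℕP.m≤n+m∸n q (isM x)) (ℕP.+-monoʳ-≤ (isM x) p))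

  count : ℕ → ℕ → ℕ → ℕ → ℕ
  count B ℓ s q = length (filter (isLComp? q s m k) (listsOf B ℓ))

  -- The same number defined by recursion on the number of parts ℓ: the empty
  -- list is the only composition of 0 and has no part m; otherwise choose the
  -- first part i+1 ≤ k and compose s-(i+1) with the remaining requirement.
  base : ℕ → ℕ → ℕ
  base zero    zero    = 1
  base zero    (suc q) = 0
  base (suc s) q       = 0

  comps : ℕ → ℕ → ℕ → ℕ
  comps zero    s q = base s q
  comps (suc ℓ) s q = ΣN.Σ k (λ i → shiftℕ (suc i) (λ s′ → comps ℓ s′ (q ∸ isM (suc i))) s)

  count-zero : ∀ B s q → count B 0 s q ≡ base s q
  count-zero B s q with isLComp? q s m k []
  count-zero B zero    zero    | yes _            = refl
  count-zero B zero    (suc q) | yes (_ , _ , ())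
  count-zero B (suc s) q       | yes (() , _)
  count-zero B zero    zero    | no ¬p             = ⊥-elim (¬p (refl , [] , z≤n))
  count-zero B zero    (suc q) | no _              = refl
  count-zero B (suc s) q       | no _              = refl

  count-first : ∀ i q s (ys : List (List ℕ)) (d : Dec (suc i ≤ k)) →
    length (filter (isLComp? q s m k) (map (suc i ∷_) ys))
      ≡ gate d (shiftℕ (suc i) (λ s′ → length (filter (isLComp? (q ∸ isM (suc i)) s′ m k) ys)) s)
  count-first i q s ys (no i≰k) =
    count-none (isLComp? q s m k) (suc i ∷_) ys (λ { y (_ , (i≤k ∷ _) , _) → i≰k i≤k })
  count-first i q s ys (yes i≤k) with suc i ≤? s
  ... | no i≰s = trans
        (count-none (isLComp? q s m k) (suc i ∷_) ys
          (λ { y (e , _) → i≰s (subst (suc i ≤_) e (ℕP.m≤m+n (suc i) _)) }))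
        (sym (shift-< 0 (suc i) s _ (ℕP.≰⇒> i≰s)))
  ... | yes i≤s with ℕP.m≤n⇒∃[o]m+o≡n i≤s
  ...   | s′ , refl = trans
          (count-map (isLComp? q (suc i + s′) m k) (isLComp? (q ∸ isM (suc i)) s′ m k) (suc i ∷_)
            (λ { y (e , (_ ∷ al) , cq) → ℕP.+-cancelˡ-≡ (suc i) _ _ e , al , atLeast-∷⇒ q (suc i) y cq })
            (λ { y (e , al , cq) → cong (_+_ (suc i)) e , i≤k ∷ al , atLeast-∷⇐ q (suc i) y cq }) ys)
          (sym (trans (shift-≥ 0 (suc i) (suc i + s′) _ i≤s)
                      (cong (λ t → length (filter (isLComp? (q ∸ isM (suc i)) t m k) ys))
                            (ℕP.m+n∸m≡n (suc i) s′))))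

  count-suc : ∀ B ℓ s q → count B (suc ℓ) s q ≡
    ΣN.Σ B (λ i → gate (suc i ≤? k) (shiftℕ (suc i) (λ s′ → count B ℓ s′ (q ∸ isM (suc i))) s))
  count-suc B ℓ s q =
    trans (count-concatMap (isLComp? q s m k) (λ i → map (suc i ∷_) (listsOf B ℓ)) (upTo B))
      (trans (ΣN.Σ-applyUpTo B (λ i → i) _)
             (ΣN.Σ-cong B _ _ (λ i → count-first i q s (listsOf B ℓ) (suc i ≤? k))))

  Σ-gate : ∀ B s (g : ℕ → ℕ) → (∀ i → s ≤ i → g i ≡ 0) → s ≤ B →
           ΣN.Σ B (λ i → gate (suc i ≤? k) (g i)) ≡ ΣN.Σ k g
  Σ-gate B s g g0 s≤B with ℕP.≤-total s k
  ... | inj₁ s≤k = begin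
      ΣN.Σ B (λ i → gate (suc i ≤? k) (g i))
    ≡⟨ ΣN.Σ-truncate s B _ (λ i s≤i → trans (cong (gate (suc i ≤? k)) (g0 i s≤i))
                                           (gate-zero (suc i ≤? k))) s≤B ⟩
      ΣN.Σ s (λ i → gate (suc i ≤? k) (g i))
    ≡⟨ ΣN.Σ-congᵇ s _ _ (λ i i<s → gate-yes (suc i ≤? k) (g i) (ℕP.≤-trans i<s s≤k)) ⟩
      ΣN.Σ s g
    ≡⟨ ΣN.Σ-truncate s k g g0 s≤k ⟨
      ΣN.Σ k g
    ∎
    where
      open ≡-Reasoning
      gate-zero : ∀ {A : Set} (d : Dec A) → gate d 0 ≡ 0
      gate-zero (yes _) = refl
      gate-zero (no _)  = refl
  ... | inj₂ k≤s = trans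
      (ΣN.Σ-truncate k B _ (λ i k≤i → gate-no (suc i ≤? k) (g i) (λ i<k → ℕP.<-irrefl refl (ℕP.≤-trans i<k k≤i)))
                     (ℕP.≤-trans k≤s s≤B))
      (ΣN.Σ-congᵇ k _ _ (λ i i<k → gate-yes (suc i ≤? k) (g i) i<k))

  -- Hence the listed count agrees with the recursive one (entries beyond s never fit).
  count-comps : ∀ ℓ B s q → s ≤ B → count B ℓ s q ≡ comps ℓ s q
  count-comps zero    B s q s≤B = count-zero B s q
  count-comps (suc ℓ) B s q s≤B =
    trans (count-suc B ℓ s q)
      (trans (ΣN.Σ-cong B _ _ (λ i → cong (gate (suc i ≤? k))
               (shift-cong 0 (suc i) s _ _ (λ t t≤s → count-comps ℓ B t _ (ℕP.≤-trans t≤s s≤B)))))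
             (Σ-gate B s _ (λ i s≤i → shift-< 0 (suc i) s _ (s≤s s≤i)) s≤B))

  comps-vanish : ∀ ℓ s q → s < ℓ → comps ℓ s q ≡ 0
  comps-vanish (suc ℓ) s q (s≤s s≤ℓ) = ΣN.Σ-zero k _ (λ i _ →
    trans (shift-cong-< 0 i s _ (λ _ → 0) (λ t t<s → comps-vanish ℓ t _ (ℕP.≤-trans t<s s≤ℓ)))
          (shift-const 0 (suc i) s))

  Lseq : ℕ → ℕ → ℕ
  Lseq q s = ΣN.Σ (suc s) (λ ℓ → comps ℓ s q)

  -- L enumerates lists of length ≤ n with entries ≤ n, covering every composition of n.
  L≡Lseq : ∀ q n → L q n m k ≡ Lseq q n
  L≡Lseq q n =
    trans (count-concatMap (isLComp? q n m k) (listsOf n) (upTo (suc n)))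
      (trans (ΣN.Σ-applyUpTo (suc n) (λ i → i) _)
             (ΣN.Σ-cong (suc n) _ _ (λ ℓ → count-comps ℓ n n q ℕP.≤-refl)))

  Lseq-rec : ∀ q s → Lseq q s ≡ base s q + ΣN.Σ k (λ i → shiftℕ (suc i) (Lseq (q ∸ isM (suc i))) s)
  Lseq-rec q s = cong (_+_ (base s q)) (begin
      ΣN.Σ s (λ ℓ → ΣN.Σ k (λ i → shiftℕ (suc i) (λ t → comps ℓ t (q′ i)) s))
    ≡⟨ ΣN.Σ-swap s k _ ⟩
      ΣN.Σ k (λ i → ΣN.Σ s (λ ℓ → shiftℕ (suc i) (λ t → comps ℓ t (q′ i)) s))
    ≡⟨ ΣN.Σ-cong k _ _ (λ i → sym (ΣN.Σ-shift (suc i) s s _)) ⟩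
      ΣN.Σ k (λ i → shiftℕ (suc i) (λ t → ΣN.Σ s (λ ℓ → comps ℓ t (q′ i))) s)
    ≡⟨ ΣN.Σ-cong k _ _ (λ i → shift-cong-< 0 i s _ _ (λ t t<s →
         ΣN.Σ-truncate (suc t) s _ (λ ℓ t<ℓ → comps-vanish ℓ t _ t<ℓ) t<s)) ⟩
      ΣN.Σ k (λ i → shiftℕ (suc i) (Lseq (q′ i)) s)
    ∎)
    where
      open ≡-Reasoning
      q′ : ℕ → ℕ
      q′ i = q ∸ isM (suc i)

cast-Σ : ∀ T (g : ℕ → ℕ) → + ΣN.Σ T g ≡ ΣZ.Σ T (λ i → + g i)
cast-Σ zero    g = refl
cast-Σ (suc T) g = trans (ℤP.pos-+ (g 0) _) (cong (ℤ._+_ (+ g 0)) (cast-Σ T _))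

cast-shift : ∀ a n (f : ℕ → ℕ) → + shiftℕ a f n ≡ shiftℤ a (λ t → + f t) n
cast-shift = shift-map +_ refl

cast-rec : ∀ k (x : ℕ) (f : ℕ → ℕ → ℕ) n →
  + (x + ΣN.Σ k (λ a → shiftℕ (suc a) (f a) n)) ≡
  + x ℤ.+ ΣZ.Σ k (λ a → shiftℤ (suc a) (λ t → + f a t) n)
cast-rec k x f n = trans (ℤP.pos-+ x _)
  (cong (ℤ._+_ (+ x)) (trans (cast-Σ k _) (ΣZ.Σ-cong k _ _ (λ a → cast-shift (suc a) n (f a)))))

recurrence-unique : (Φ : (ℕ → ℤ) → ℕ → ℤ) →
  (∀ f g n → (∀ t → t < n → f t ≡ g t) → Φ f n ≡ Φ g n) →
  (f g : ℕ → ℤ) → (∀ n → f n ≡ Φ f n) → (∀ n → g n ≡ Φ g n) → ∀ n → f n ≡ g n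
recurrence-unique Φ local f g f-rec g-rec n = agree (suc n) n ℕP.≤-refl
  where
    agree : ∀ N t → t < N → f t ≡ g t
    agree (suc N) t (s≤s t≤N) =
      trans (f-rec t) (trans (local f g t (λ t′ t′<t → agree N t′ (ℕP.≤-trans t′<t t≤N))) (sym (g-rec t)))

Σ-replace : ∀ K j (h x : ℕ → ℤ) y → j < K → (∀ i → ¬ i ≡ j → h i ≡ x i) → h j ≡ y →
            ΣZ.Σ K h ≡ (ΣZ.Σ K x ℤ.- x j) ℤ.+ y
Σ-replace (suc K) zero h x y _ hx hy =
  trans (cong₂ ℤ._+_ hy (ΣZ.Σ-cong K _ _ (λ i → hx (suc i) (λ ())))) (rearrange (x 0) y _)
  where
    rearrange : ∀ a b S → b ℤ.+ S ≡ ((a ℤ.+ S) ℤ.- a) ℤ.+ b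
    rearrange = solve-∀
Σ-replace (suc K) (suc j) h x y (s≤s j<K) hx hy =
  trans (cong₂ ℤ._+_ (hx 0 (λ ()))
          (Σ-replace K j (h ∘ suc) (x ∘ suc) y j<K (λ i i≢j → hx (suc i) (i≢j ∘ ℕP.suc-injective)) hy))
        (rearrange (x 0) (ΣZ.Σ K (x ∘ suc)) (x (suc j)) y)
  where
    rearrange : ∀ a S xj b → a ℤ.+ ((S ℤ.- xj) ℤ.+ b) ≡ ((a ℤ.+ S) ℤ.- xj) ℤ.+ b
    rearrange = solve-∀

weight : ℕ → ℕ → ℤ → ℤ
weight q i x = (-1ℤ ℤ.^ i) ℤ.* (+ ((q + i) C q) ℤ.* x)

weight-0ℤ : ∀ q i → weight q i 0ℤ ≡ 0ℤ
weight-0ℤ q i = trans (cong (ℤ._*_ (-1ℤ ℤ.^ i)) (ℤP.*-zeroʳ (+ ((q + i) C q)))) (ℤP.*-zeroʳ (-1ℤ ℤ.^ i))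

weight-+ : ∀ q i x y → weight q i (x ℤ.+ y) ≡ weight q i x ℤ.+ weight q i y
weight-+ q i x y = distrib (-1ℤ ℤ.^ i) (+ ((q + i) C q)) x y
  where
    distrib : ∀ s b x y → s ℤ.* (b ℤ.* (x ℤ.+ y)) ≡ s ℤ.* (b ℤ.* x) ℤ.+ s ℤ.* (b ℤ.* y)
    distrib = solve-∀

weight-Σ : ∀ q i T (f : ℕ → ℤ) → weight q i (ΣZ.Σ T f) ≡ ΣZ.Σ T (λ a → weight q i (f a))
weight-Σ q i zero    f = weight-0ℤ q i
weight-Σ q i (suc T) f = trans (weight-+ q i _ _) (cong (ℤ._+_ (weight q i (f 0))) (weight-Σ q i T _))

weight-shift : ∀ q i a n (f : ℕ → ℤ) → weight q i (shiftℤ a f n) ≡ shiftℤ a (λ t → weight q i (f t)) n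
weight-shift q i = shift-map (weight q i) (weight-0ℤ q i)

weight-first : ∀ q x → weight q 0 x ≡ x
weight-first q x = begin
  ℤ.1ℤ ℤ.* (+ ((q + 0) C q) ℤ.* x) ≡⟨ ℤP.*-identityˡ _ ⟩
  + ((q + 0) C q) ℤ.* x            ≡⟨ cong (λ t → + (t C q) ℤ.* x) (ℕP.+-identityʳ q) ⟩
  + (q C q) ℤ.* x                  ≡⟨ cong (λ b → + b ℤ.* x) (nCn≡1 q) ⟩
  ℤ.1ℤ ℤ.* x                       ≡⟨ ℤP.*-identityˡ x ⟩
  x                                ∎
  where open ≡-Reasoning

weight-pascal : ∀ q i x → weight (suc q) (suc i) x ℤ.+ weight (suc q) i x ≡ weight q (suc i) x
weight-pascal q i x = begin
    (-1ℤ ℤ.* s) ℤ.* (+ ((suc q + suc i) C suc q) ℤ.* x) ℤ.+ s ℤ.* (+ Y ℤ.* x)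
  ≡⟨ cong (λ b → (-1ℤ ℤ.* s) ℤ.* (b ℤ.* x) ℤ.+ s ℤ.* (+ Y ℤ.* x)) (trans (cong +_ binom) (ℤP.pos-+ X Y)) ⟩
    (-1ℤ ℤ.* s) ℤ.* ((+ X ℤ.+ + Y) ℤ.* x) ℤ.+ s ℤ.* (+ Y ℤ.* x)
  ≡⟨ cancel s (+ X) (+ Y) x ⟩
    (-1ℤ ℤ.* s) ℤ.* (+ X ℤ.* x)
  ≡⟨ cong (λ t → (-1ℤ ℤ.* s) ℤ.* (+ (t C q) ℤ.* x)) (sym (ℕP.+-suc q i)) ⟩
    (-1ℤ ℤ.* s) ℤ.* (+ ((q + suc i) C q) ℤ.* x)
  ∎
  where
    open ≡-Reasoning
    s : ℤ
    s = -1ℤ ℤ.^ i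
    X Y : ℕ
    X = suc (q + i) C q
    Y = suc (q + i) C suc q
    binom : (suc q + suc i) C suc q ≡ X + Y
    binom = trans (cong (λ t → suc t C suc q) (ℕP.+-suc q i))
                  (sym (nCk+nC[k+1]≡[n+1]C[k+1] (suc (q + i)) q))
    cancel : ∀ s X Y x → (-1ℤ ℤ.* s) ℤ.* ((X ℤ.+ Y) ℤ.* x) ℤ.+ s ℤ.* (Y ℤ.* x) ≡ (-1ℤ ℤ.* s) ℤ.* (X ℤ.* x)
    cancel = solve-∀

F3-shift : ∀ k a n j → F3 (+ (n + 1) ℤ.- + a) k j ≡ shiftℕ a (coef k j) n
F3-shift k a n j with a ≤? n
... | yes a≤n = begin
    F3 (+ (n + 1) ℤ.- + a) k j   ≡⟨ cong (λ z → F3 z k j) (trans (ℤP.m-n≡m⊖n (n + 1) a) (ℤP.⊖-≥ (ℕP.m≤n⇒m≤n+o 1 a≤n))) ⟩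
    F3 (+ (n + 1 ∸ a)) k j       ≡⟨ cong (λ z → F3 (+ z) k j) (trans (ℕP.+-∸-comm 1 a≤n) (ℕP.+-comm (n ∸ a) 1)) ⟩
    coef k j (n ∸ a)             ≡⟨ shift-≥ 0 a n _ a≤n ⟨
    shiftℕ a (coef k j) n        ∎
  where open ≡-Reasoning
... | no a≰n = begin
    F3 (+ (n + 1) ℤ.- + a) k j   ≡⟨ cong (λ z → F3 z k j) (trans (ℤP.m-n≡m⊖n (n + 1) a) (ℤP.⊖-≤ n+1≤a)) ⟩
    F3 (ℤ.- + (a ∸ (n + 1))) k j ≡⟨ F3-nonpositive (a ∸ (n + 1)) ⟩
    0                            ≡⟨ shift-< 0 a n _ (ℕP.≰⇒> a≰n) ⟨
    shiftℕ a (coef k j) n        ∎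
  where
    open ≡-Reasoning
    n+1≤a : n + 1 ≤ a
    n+1≤a = subst (_≤ a) (ℕP.+-comm 1 n) (ℕP.≰⇒> a≰n)
    F3-nonpositive : ∀ x → F3 (ℤ.- + x) k j ≡ 0
    F3-nonpositive zero    = refl
    F3-nonpositive (suc x) = refl

module AlternatingSum (k m′ : ℕ) (m≤k : suc m′ ≤ k) where

  m : ℕ
  m = suc m′

  open Fibonacci k
  open Shifted m
  open Compositions k m

  Uℤ : ℕ → ℕ → ℤ
  Uℤ j n = + U j n

  c-recℤ : ∀ n → Uℤ 0 n ≡ + δ n ℤ.+ ΣZ.Σ k (λ a → shiftℤ (suc a) (Uℤ 0) n)
  c-recℤ n = trans (cong +_ (c-rec n)) (cast-rec k (δ n) (λ _ → c) n)

  U-recℤ : ∀ j n → Uℤ (suc j) n ≡ shiftℤ m (Uℤ j) n ℤ.+ ΣZ.Σ k (λ a → shiftℤ (suc a) (Uℤ (suc j)) n)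
  U-recℤ j n = trans (cong +_ (U-rec j n))
    (trans (cast-rec k (shiftℕ m (U j) n) (λ _ → U (suc j)) n)
           (cong (λ z → z ℤ.+ ΣZ.Σ k (λ a → shiftℤ (suc a) (Uℤ (suc j)) n)) (cast-shift m n (U j))))

  -- U_j starts at x^{jm}, so its coefficient at n < j vanishes.
  U-vanish : ∀ j n → n < j → Uℤ j n ≡ 0ℤ
  U-vanish j n n<j = cong +_ (shift-< 0 (j * m) n _ (ℕP.≤-trans n<j (ℕP.m≤m*n j m)))

  -- R_q truncated to its first T summands, and R_q itself (all further summands vanish).
  Rpartial : ℕ → ℕ → ℕ → ℤ
  Rpartial q T n = ΣZ.Σ T (λ i → weight q i (Uℤ (suc q + i) n))

  R : ℕ → ℕ → ℤ
  R q n = Rpartial q (suc n) n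

  Rpartial-R : ∀ q T n → n ≤ T → Rpartial q T n ≡ R q n
  Rpartial-R q T n n≤T = trans (truncate T n≤T) (sym (truncate (suc n) (ℕP.n≤1+n n)))
    where
      truncate : ∀ T → n ≤ T → Rpartial q T n ≡ Rpartial q n n
      truncate T = ΣZ.Σ-truncate n T _ (λ i n≤i →
        trans (cong (weight q i) (U-vanish (suc q + i) n (s≤s (ℕP.≤-trans n≤i (ℕP.m≤n+m i q)))))
              (weight-0ℤ q i))

  below : ℕ → ℕ → ℤ
  below zero    = Uℤ 0
  below (suc q) = R q

  Rlowered : ℕ → ℕ → ℕ → ℤ
  Rlowered q T t = ΣZ.Σ T (λ i → weight q i (Uℤ (q + i) t))

  -- Pascal's rule makes the sum telescope: lowering every U index of R_q gives below_q - R_q.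
  telescope-0 : ∀ T t → Rlowered 0 (suc T) t ℤ.+ Rpartial 0 T t ≡ Uℤ 0 t
  telescope-0 T t = begin
      (weight 0 0 (Uℤ 0 t) ℤ.+ S₁) ℤ.+ S₂   ≡⟨ ℤP.+-assoc (weight 0 0 (Uℤ 0 t)) S₁ S₂ ⟩
      weight 0 0 (Uℤ 0 t) ℤ.+ (S₁ ℤ.+ S₂)   ≡⟨ cong (ℤ._+_ (weight 0 0 (Uℤ 0 t))) pairs-cancel ⟩
      weight 0 0 (Uℤ 0 t) ℤ.+ 0ℤ            ≡⟨ trans (ℤP.+-identityʳ _) (weight-first 0 _) ⟩
      Uℤ 0 t                                ∎
    where
      open ≡-Reasoning
      S₁ S₂ : ℤ
      S₁ = ΣZ.Σ T (λ i → weight 0 (suc i) (Uℤ (suc i) t))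
      S₂ = Rpartial 0 T t
      cancel : ∀ s x → (-1ℤ ℤ.* s) ℤ.* (ℤ.1ℤ ℤ.* x) ℤ.+ s ℤ.* (ℤ.1ℤ ℤ.* x) ≡ 0ℤ
      cancel = solve-∀
      pairs-cancel : S₁ ℤ.+ S₂ ≡ 0ℤ
      pairs-cancel = trans (sym (ΣZ.Σ-+ T _ _)) (ΣZ.Σ-zero T _ (λ i _ → cancel (-1ℤ ℤ.^ i) (Uℤ (suc i) t)))

  telescope-suc : ∀ q T t → Rlowered (suc q) (suc T) t ℤ.+ Rpartial (suc q) T t ≡ Rpartial q (suc T) t
  telescope-suc q T t = begin
      (weight (suc q) 0 u₀ ℤ.+ S₁) ℤ.+ S₂   ≡⟨ ℤP.+-assoc (weight (suc q) 0 u₀) S₁ S₂ ⟩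
      weight (suc q) 0 u₀ ℤ.+ (S₁ ℤ.+ S₂)   ≡⟨ cong₂ ℤ._+_ (trans (weight-first (suc q) u₀) (sym (weight-first q u₀)))
                                                         (trans (sym (ΣZ.Σ-+ T _ _)) (ΣZ.Σ-cong T _ _ pascal)) ⟩
      Rpartial q (suc T) t                  ∎
    where
      open ≡-Reasoning
      u₀ : ℤ
      u₀ = Uℤ (suc q + 0) t
      S₁ S₂ : ℤ
      S₁ = ΣZ.Σ T (λ i → weight (suc q) (suc i) (Uℤ (suc q + suc i) t))
      S₂ = Rpartial (suc q) T t
      pascal : ∀ i → weight (suc q) (suc i) (Uℤ (suc q + suc i) t) ℤ.+ weight (suc q) i (Uℤ (suc (suc q) + i) t)
                     ≡ weight q (suc i) (Uℤ (suc q + suc i) t)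
      pascal i = trans (cong (λ j → weight (suc q) (suc i) (Uℤ (suc q + suc i) t) ℤ.+ weight (suc q) i (Uℤ (suc j) t)) (sym (ℕP.+-suc q i)))
                       (weight-pascal q i (Uℤ (suc q + suc i) t))

  lowered : ∀ q n t → t ≤ n → Rlowered q (suc n) t ≡ below q t ℤ.- R q t
  lowered q n t t≤n = begin
      Rlowered q (suc n) t                                         ≡⟨ add-sub _ (Rpartial q n t) ⟩
      (Rlowered q (suc n) t ℤ.+ Rpartial q n t) ℤ.- Rpartial q n t ≡⟨ cong₂ ℤ._-_ (telescope q) (Rpartial-R q n t t≤n) ⟩
      below q t ℤ.- R q t                                          ∎
    where
      open ≡-Reasoning
      add-sub : ∀ x y → x ≡ (x ℤ.+ y) ℤ.- y
      add-sub = solve-∀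
      telescope : ∀ q → Rlowered q (suc n) t ℤ.+ Rpartial q n t ≡ below q t
      telescope zero    = telescope-0 n t
      telescope (suc q) = trans (telescope-suc q n t) (Rpartial-R q (suc n) t (ℕP.m≤n⇒m≤1+n t≤n))

  -- The recurrence shared by L_{q+1} and R_q, given the level g below.
  Φ : (ℕ → ℤ) → (ℕ → ℤ) → ℕ → ℤ
  Φ g f n = (shiftℤ m g n ℤ.- shiftℤ m f n) ℤ.+ ΣZ.Σ k (λ a → shiftℤ (suc a) f n)

  Φ-local : ∀ g f f′ n → (∀ t → t < n → f t ≡ f′ t) → Φ g f n ≡ Φ g f′ n
  Φ-local g f f′ n h =
    cong₂ ℤ._+_ (cong (ℤ._-_ (shiftℤ m g n)) (shift-cong-< 0ℤ m′ n f f′ h))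
                (ΣZ.Σ-cong k _ _ (λ a → shift-cong-< 0ℤ a n f f′ h))

  Φ-below : ∀ g g′ f n → (∀ t → g t ≡ g′ t) → Φ g f n ≡ Φ g′ f n
  Φ-below g g′ f n h = cong (λ z → (z ℤ.- shiftℤ m f n) ℤ.+ ΣZ.Σ k (λ a → shiftℤ (suc a) f n))
                            (shift-cong 0ℤ m n g g′ (λ t _ → h t))

  -- Apply U-rec to every summand of R_q; the x^m parts form x^m·Rlowered_q.
  R-rec : ∀ q n → R q n ≡ Φ (below q) (R q) n
  R-rec q n = begin
      R q n
    ≡⟨ ΣZ.Σ-cong (suc n) _ _ (λ i → trans (cong (weight q i) (U-recℤ (q + i) n))
         (trans (weight-+ q i _ _) (cong (ℤ._+_ (weight q i (shiftℤ m (Uℤ (q + i)) n))) (weight-Σ q i k _)))) ⟩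
      ΣZ.Σ (suc n) (λ i → weight q i (shiftℤ m (Uℤ (q + i)) n)
                          ℤ.+ ΣZ.Σ k (λ a → weight q i (shiftℤ (suc a) (Uℤ (suc q + i)) n)))
    ≡⟨ ΣZ.Σ-+ (suc n) (λ i → weight q i (shiftℤ m (Uℤ (q + i)) n))
                      (λ i → ΣZ.Σ k (λ a → weight q i (shiftℤ (suc a) (Uℤ (suc q + i)) n))) ⟩
      ΣZ.Σ (suc n) (λ i → weight q i (shiftℤ m (Uℤ (q + i)) n))
        ℤ.+ ΣZ.Σ (suc n) (λ i → ΣZ.Σ k (λ a → weight q i (shiftℤ (suc a) (Uℤ (suc q + i)) n)))
    ≡⟨ cong₂ ℤ._+_ lowered-part (trans (ΣZ.Σ-swap (suc n) k (λ i a → weight q i (shiftℤ (suc a) (Uℤ (suc q + i)) n))) (ΣZ.Σ-cong k _ _ shifted-part)) ⟩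
      Φ (below q) (R q) n
    ∎
    where
      open ≡-Reasoning
      lowered-part : ΣZ.Σ (suc n) (λ i → weight q i (shiftℤ m (Uℤ (q + i)) n)) ≡ shiftℤ m (below q) n ℤ.- shiftℤ m (R q) n
      lowered-part = begin
          ΣZ.Σ (suc n) (λ i → weight q i (shiftℤ m (Uℤ (q + i)) n))
        ≡⟨ trans (ΣZ.Σ-cong (suc n) _ _ (λ i → weight-shift q i m n (Uℤ (q + i)))) (sym (ΣZ.Σ-shift m (suc n) n (λ i t → weight q i (Uℤ (q + i) t)))) ⟩
          shiftℤ m (Rlowered q (suc n)) n
        ≡⟨ shift-cong 0ℤ m n _ _ (lowered q n) ⟩
          shiftℤ m (λ t → below q t ℤ.- R q t) n
        ≡⟨ ΣZ.shift-⊕ m n (below q) (λ t → ℤ.- R q t) ⟩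
          shiftℤ m (below q) n ℤ.+ shiftℤ m (λ t → ℤ.- R q t) n
        ≡⟨ cong (ℤ._+_ (shiftℤ m (below q) n)) (sym (shift-map ℤ.-_ refl m n (R q))) ⟩
          shiftℤ m (below q) n ℤ.- shiftℤ m (R q) n
        ∎
      shifted-part : ∀ a → ΣZ.Σ (suc n) (λ i → weight q i (shiftℤ (suc a) (Uℤ (suc q + i)) n)) ≡ shiftℤ (suc a) (R q) n
      shifted-part a =
        trans (ΣZ.Σ-cong (suc n) _ _ (λ i → weight-shift q i (suc a) n (Uℤ (suc q + i))))
          (trans (sym (ΣZ.Σ-shift (suc a) (suc n) n (λ i t → weight q i (Uℤ (suc q + i) t))))
                 (shift-cong 0ℤ (suc a) n (Rpartial q (suc n)) (R q) (λ t t≤n → Rpartial-R q (suc n) t (ℕP.m≤n⇒m≤1+n t≤n))))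

  Lℤ : ℕ → ℕ → ℤ
  Lℤ q n = + Lseq q n

  Lseq-recℤ : ∀ q n → Lℤ q n ≡ + base n q ℤ.+ ΣZ.Σ k (λ i → shiftℤ (suc i) (Lℤ (q ∸ isM (suc i))) n)
  Lseq-recℤ q n = trans (cong +_ (Lseq-rec q n)) (cast-rec k (base n q) (λ i → Lseq (q ∸ isM (suc i))) n)

  Φ₀ : (ℕ → ℤ) → ℕ → ℤ
  Φ₀ f n = + δ n ℤ.+ ΣZ.Σ k (λ a → shiftℤ (suc a) f n)

  Φ₀-local : ∀ f f′ n → (∀ t → t < n → f t ≡ f′ t) → Φ₀ f n ≡ Φ₀ f′ n
  Φ₀-local f f′ n h = cong (ℤ._+_ (+ δ n)) (ΣZ.Σ-cong k _ _ (λ a → shift-cong-< 0ℤ a n f f′ h))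

  L₀-rec : ∀ n → Lℤ 0 n ≡ Φ₀ (Lℤ 0) n
  L₀-rec n = trans (Lseq-recℤ 0 n)
    (cong₂ ℤ._+_ (cong +_ (base-δ n))
                 (ΣZ.Σ-cong k _ _ (λ i → cong (λ q → shiftℤ (suc i) (Lℤ q) n) (ℕP.0∸n≡0 (isM (suc i))))))
    where
      base-δ : ∀ n → base n 0 ≡ δ n
      base-δ zero    = refl
      base-δ (suc n) = refl

  -- The first part is m exactly in the summand i = m′, where one required part m is used up.
  Lsuc-rec : ∀ q n → Lℤ (suc q) n ≡ Φ (Lℤ q) (Lℤ (suc q)) n
  Lsuc-rec q n = begin
      Lℤ (suc q) n
    ≡⟨ Lseq-recℤ (suc q) n ⟩
      + base n (suc q) ℤ.+ S
    ≡⟨ trans (cong (λ z → + z ℤ.+ S) (base-suc n)) (ℤP.+-identityˡ S) ⟩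
      S
    ≡⟨ Σ-replace k m′ _ (λ i → shiftℤ (suc i) (Lℤ (suc q)) n) (shiftℤ m (Lℤ q) n) m≤k
         (λ i i≢m′ → cong (λ z → shiftℤ (suc i) (Lℤ (suc q ∸ z)) n) (isM-≢ (suc i) (i≢m′ ∘ ℕP.suc-injective)))
         (cong (λ z → shiftℤ m (Lℤ (suc q ∸ z)) n) isM-m) ⟩
      (ΣZ.Σ k (λ i → shiftℤ (suc i) (Lℤ (suc q)) n) ℤ.- shiftℤ m (Lℤ (suc q)) n) ℤ.+ shiftℤ m (Lℤ q) n
    ≡⟨ rearrange (ΣZ.Σ k (λ i → shiftℤ (suc i) (Lℤ (suc q)) n)) (shiftℤ m (Lℤ (suc q)) n) (shiftℤ m (Lℤ q) n) ⟩
      Φ (Lℤ q) (Lℤ (suc q)) n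
    ∎
    where
      open ≡-Reasoning
      S : ℤ
      S = ΣZ.Σ k (λ i → shiftℤ (suc i) (Lℤ (suc q ∸ isM (suc i))) n)
      base-suc : ∀ n → base n (suc q) ≡ 0
      base-suc zero    = refl
      base-suc (suc n) = refl
      rearrange : ∀ S a b → (S ℤ.- a) ℤ.+ b ≡ (b ℤ.- a) ℤ.+ S
      rearrange = solve-∀

  -- By induction on q: L_0 = U_0 and L_{q+1} = R_q, since both sides solve the same recurrence.
  L≡below : ∀ q n → Lℤ q n ≡ below q n
  L≡below zero    = recurrence-unique Φ₀ Φ₀-local (Lℤ 0) (Uℤ 0) L₀-rec c-recℤ
  L≡below (suc q) = recurrence-unique (Φ (below q)) (Φ-local (below q)) (Lℤ (suc q)) (R q)
    (λ n → trans (Lsuc-rec q n) (Φ-below (Lℤ q) (below q) (Lℤ (suc q)) n (L≡below q)))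
    (R-rec q)

  R≡RHS : ∀ q n → R q n ≡ RHS (suc q) n m k
  R≡RHS q n = sym (trans (ΣZ.Σ-applyUpTo (suc n) (λ i → i) (λ i → term (suc q) n m k (suc q + i)))
                         (ΣZ.Σ-cong (suc n) _ _ term≡))
    where
      term≡ : ∀ i → term (suc q) n m k (suc q + i) ≡ weight q i (Uℤ (suc q + i) n)
      term≡ i = cong₂ ℤ._*_ (cong (-1ℤ ℤ.^_) (ℕP.m+n∸m≡n (suc q) i))
        (cong (λ z → + ((q + i) C q) ℤ.* + z) (F3-shift k ((suc q + i) * m) n (suc q + i)))

  theorem : ∀ q n → + L (suc q) n m k ≡ RHS (suc q) n m k
  theorem q n = begin
    + L (suc q) n m k   ≡⟨ cong +_ (L≡Lseq (suc q) n) ⟩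
    Lℤ (suc q) n        ≡⟨ L≡below (suc q) n ⟩
    R q n               ≡⟨ R≡RHS q n ⟩
    RHS (suc q) n m k   ∎
    where open ≡-Reasoning

mainTheorem8 : (p k n m : ℕ) → NonZero p → NonZero k → NonZero n → NonZero m →
    m ≤ k → + (L p n m k) ≡ RHS p n m k
mainTheorem8 zero    k n m       p≢0 _ _ _   _   = ⊥-elim (NonZero.nonZero p≢0)
mainTheorem8 (suc q) k n zero    _   _ _ m≢0 _   = ⊥-elim (NonZero.nonZero m≢0)
mainTheorem8 (suc q) k n (suc m′) _  _ _ _   m≤k = AlternatingSum.theorem k m′ m≤k q n
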